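{- Let $\lambda\in\mathbb{C}$ and let $m,n\ge0$ be integers. Then \[ (m+n)_\lambda!=\sum_{j=0}^m{m \brack j}_\lambda\langle 1+m\lambda\rangle_{n,\lambda}=\sum_{j=0}^m\sum_{k=0}^n{m \brack j}_\lambda\binom{n}{k}\langle m\lambda\rangle_{n-k,\lambda}\langle 1\rangle_{k,\lambda}. \]
   Context: For $\lambda\in\mathbb{C}$, the $\lambda$-rising factorial is $\langle x\rangle_{0,\lambda}=1$, $\langle x\rangle_{n,\lambda}=x(x+\lambda)\cdots(x+(n-1)\lambda)$ for $n\ge1$. The unsigned $\lambda$-Stirling numbers of the first kind are defined by $\langle x\rangle_{n,\lambda}=\sum_{k=0}^n {n \brack k}_\lambda x^k$. The $\lambda$-factorial is $(0)_\lambda!=1$ and $(n)_\lambda!=\langle 1\rangle_{n,\lambda}=\sum_{k=0}^n{n \brack k}_\lambda$ for $n\ge1$. -}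

module Defs where

open import Level using (Level)
open import Algebra.Bundles using (CommutativeRing)
open import Data.Nat using (ℕ; zero; suc)
open import Data.List using (List; []; _∷_)

-- All notions are defined over an arbitrary commutative ring R
-- (the paper works over ℂ, which is not available).
module _ {c ℓ : Level} (R : CommutativeRing c ℓ) where
  open CommutativeRing R using (Carrier; _+_; _*_; 0#; 1#)

  nat : ℕ → Carrier
  nat zero    = 0#
  nat (suc n) = 1# + nat n

  sumTo : ℕ → (ℕ → Carrier) → Carrier
  sumTo zero    f = f zero
  sumTo (suc m) f = sumTo m f + f (suc m)

  rising : (lam : Carrier) → Carrier → ℕ → Carrier
  rising lam a zero    = 1#
  rising lam a (suc n) = rising lam a n * (a + nat n * lam)

  -- polynomials in x with coefficients in R, as ascending coefficient lists
  scaleP : Carrier → List Carrier → List Carrier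
  scaleP c' []      = []
  scaleP c' (a ∷ p) = c' * a ∷ scaleP c' p

  addP : List Carrier → List Carrier → List Carrier
  addP []      q       = q
  addP (a ∷ p) []      = a ∷ p
  addP (a ∷ p) (b ∷ q) = a + b ∷ addP p q

  mulXplus : Carrier → List Carrier → List Carrier
  mulXplus c' p = addP (0# ∷ p) (scaleP c' p)

  coeff : List Carrier → ℕ → Carrier
  coeff []      k       = 0#
  coeff (a ∷ p) zero    = a
  coeff (a ∷ p) (suc k) = coeff p k

  risingPoly : (lam : Carrier) → ℕ → List Carrier
  risingPoly lam zero    = 1# ∷ []
  risingPoly lam (suc n) = mulXplus (nat n * lam) (risingPoly lam n)

  -- unsigned λ-Stirling numbers of the first kind: [n k]_λ = coefficient of x^k in ⟨x⟩_{n,λ}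
  stirling1 : (lam : Carrier) → ℕ → ℕ → Carrier
  stirling1 lam n k = coeff (risingPoly lam n) k

  lamFact : (lam : Carrier) → ℕ → Carrier
  lamFact lam n = rising lam 1# n

{-# OPTIONS --safe #-}
-- The λ-rising factorial splits as ⟨1⟩_{m+n,λ} = ⟨1⟩_{m,λ} ⟨1+mλ⟩_{n,λ}, and ⟨1⟩_{m,λ} is the
-- polynomial ⟨x⟩_{m,λ} evaluated at x = 1, i.e. the sum of its coefficients [m j]_λ. The second
-- equality is the λ-Vandermonde identity ⟨a+b⟩_{n,λ} = Σ_k C(n,k) ⟨b⟩_{n-k,λ} ⟨a⟩_{k,λ}, proved
-- by induction on n: multiplying by a+b+nλ = (a+kλ) + (b+(n-k)λ) raises one of the two factors
-- of each term, and Pascal's rule recombines the two resulting sums.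
module Submission where

open import Defs
open import Level using (Level)
open import Algebra.Bundles using (CommutativeRing)
open import Data.Nat using (ℕ; zero; suc; _∸_; _≤_; _≤?_; s≤s) renaming (_+_ to _+ℕ_)
import Data.Nat.Properties as ℕ
open import Data.Nat.Combinatorics using (_C_; k>n⇒nCk≡0; nCk+nC[k+1]≡[n+1]C[k+1])
open import Data.List using (List; []; _∷_; length)
open import Data.Product using (_×_; _,_)
open import Relation.Nullary using (yes; no)
import Relation.Binary.PropositionalEquality as ≡

module _ {c ℓ : Level} (R : CommutativeRing c ℓ) where
  open CommutativeRing R hiding (zero)
  open import Algebra.Solver.Ring.NaturalCoefficients.Default commutativeSemiring
  open import Relation.Binary.Reasoning.Setoid setoid

  nat-+ : ∀ m n → nat R (m +ℕ n) ≈ nat R m + nat R n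
  nat-+ zero    n = sym (+-identityˡ _)
  nat-+ (suc m) n = trans (+-cong refl (nat-+ m n)) (sym (+-assoc _ _ _))

  sumTo-cong : ∀ N {f g : ℕ → Carrier} → (∀ k → f k ≈ g k) → sumTo R N f ≈ sumTo R N g
  sumTo-cong zero    f≈g = f≈g 0
  sumTo-cong (suc N) f≈g = +-cong (sumTo-cong N f≈g) (f≈g (suc N))

  sumTo-+ : ∀ N (f g : ℕ → Carrier) →
            sumTo R N (λ k → f k + g k) ≈ sumTo R N f + sumTo R N g
  sumTo-+ zero    f g = refl
  sumTo-+ (suc N) f g = trans (+-cong (sumTo-+ N f g) refl)
    (solve 4 (λ a b x y → (a :+ b) :+ (x :+ y) := (a :+ x) :+ (b :+ y)) refl _ _ _ _)

  sumTo-*ʳ : ∀ N (f : ℕ → Carrier) x → sumTo R N f * x ≈ sumTo R N (λ k → f k * x)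
  sumTo-*ʳ zero    f x = refl
  sumTo-*ʳ (suc N) f x = trans (distribʳ _ _ _) (+-cong (sumTo-*ʳ N f x) refl)

  sumTo-*ˡ : ∀ N (f : ℕ → Carrier) x → x * sumTo R N f ≈ sumTo R N (λ k → x * f k)
  sumTo-*ˡ zero    f x = refl
  sumTo-*ˡ (suc N) f x = trans (distribˡ _ _ _) (+-cong (sumTo-*ˡ N f x) refl)

  sumTo-suc-shift : ∀ N (f : ℕ → Carrier) → sumTo R (suc N) f ≈ f 0 + sumTo R N (λ k → f (suc k))
  sumTo-suc-shift zero    f = refl
  sumTo-suc-shift (suc N) f = trans (+-cong (sumTo-suc-shift N f) refl) (+-assoc _ _ _)

  sumTo-suc-last-0 : ∀ N (f : ℕ → Carrier) → f (suc N) ≈ 0# → sumTo R (suc N) f ≈ sumTo R N f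
  sumTo-suc-last-0 N f fN≈0 = trans (+-cong refl fN≈0) (+-identityʳ _)

  sumCoeffs : List Carrier → Carrier
  sumCoeffs []      = 0#
  sumCoeffs (a ∷ p) = a + sumCoeffs p

  sumTo-coeff : ∀ N p → length p ≡.≡ suc N → sumTo R N (coeff R p) ≈ sumCoeffs p
  sumTo-coeff zero    (a ∷ [])    _   = sym (+-identityʳ a)
  sumTo-coeff (suc N) (a ∷ p)     len = trans (sumTo-suc-shift N (coeff R (a ∷ p)))
                                              (+-cong refl (sumTo-coeff N p (ℕ.suc-injective len)))

  length-scaleP : ∀ x p → length (scaleP R x p) ≡.≡ length p
  length-scaleP x []      = ≡.refl
  length-scaleP x (a ∷ p) = ≡.cong suc (length-scaleP x p)

  length-addP : ∀ p q → length q ≤ length p → length (addP R p q) ≡.≡ length p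
  length-addP []      q       q≤p       = ℕ.n≤0⇒n≡0 q≤p
  length-addP (a ∷ p) []      _         = ≡.refl
  length-addP (a ∷ p) (b ∷ q) (s≤s q≤p) = ≡.cong suc (length-addP p q q≤p)

  length-mulXplus : ∀ x p → length (mulXplus R x p) ≡.≡ suc (length p)
  length-mulXplus x p = length-addP (0# ∷ p) (scaleP R x p)
    (ℕ.≤-trans (ℕ.≤-reflexive (length-scaleP x p)) (ℕ.n≤1+n _))

  length-risingPoly : ∀ lam n → length (risingPoly R lam n) ≡.≡ suc n
  length-risingPoly lam zero    = ≡.refl
  length-risingPoly lam (suc n) =
    ≡.trans (length-mulXplus _ (risingPoly R lam n)) (≡.cong suc (length-risingPoly lam n))

  sumCoeffs-addP : ∀ p q → sumCoeffs (addP R p q) ≈ sumCoeffs p + sumCoeffs q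
  sumCoeffs-addP []      q       = sym (+-identityˡ _)
  sumCoeffs-addP (a ∷ p) []      = sym (+-identityʳ _)
  sumCoeffs-addP (a ∷ p) (b ∷ q) = trans (+-cong refl (sumCoeffs-addP p q))
    (solve 4 (λ a b x y → (a :+ b) :+ (x :+ y) := (a :+ x) :+ (b :+ y)) refl _ _ _ _)

  sumCoeffs-scaleP : ∀ x p → sumCoeffs (scaleP R x p) ≈ x * sumCoeffs p
  sumCoeffs-scaleP x []      = sym (zeroʳ x)
  sumCoeffs-scaleP x (a ∷ p) = trans (+-cong refl (sumCoeffs-scaleP x p)) (sym (distribˡ _ _ _))

  sumCoeffs-mulXplus : ∀ x p → sumCoeffs (mulXplus R x p) ≈ sumCoeffs p * (1# + x)
  sumCoeffs-mulXplus x p = begin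
    sumCoeffs (addP R (0# ∷ p) (scaleP R x p))  ≈⟨ sumCoeffs-addP (0# ∷ p) (scaleP R x p) ⟩
    (0# + sumCoeffs p) + sumCoeffs (scaleP R x p) ≈⟨ +-cong (+-identityˡ _) (sumCoeffs-scaleP x p) ⟩
    sumCoeffs p + x * sumCoeffs p               ≈⟨ solve 2 (λ s x → s :+ x :* s := s :* (con 1 :+ x)) refl _ _ ⟩
    sumCoeffs p * (1# + x)                      ∎

  sumCoeffs-risingPoly : ∀ lam n → sumCoeffs (risingPoly R lam n) ≈ lamFact R lam n
  sumCoeffs-risingPoly lam zero    = +-identityʳ _
  sumCoeffs-risingPoly lam (suc n) =
    trans (sumCoeffs-mulXplus _ (risingPoly R lam n)) (*-cong (sumCoeffs-risingPoly lam n) refl)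

  sumTo-stirling1 : ∀ lam n → sumTo R n (stirling1 R lam n) ≈ lamFact R lam n
  sumTo-stirling1 lam n = trans (sumTo-coeff n (risingPoly R lam n) (length-risingPoly lam n))
                                (sumCoeffs-risingPoly lam n)

  rising-+ : ∀ lam a m n →
             rising R lam a (m +ℕ n) ≈ rising R lam a m * rising R lam (a + nat R m * lam) n
  rising-+ lam a m zero    rewrite ℕ.+-identityʳ m = sym (*-identityʳ _)
  rising-+ lam a m (suc n) rewrite ℕ.+-suc m n =
    trans (*-cong (rising-+ lam a m n) (+-cong refl (*-cong (nat-+ m n) refl)))
      (solve 6 (λ X Y a p q l → (X :* Y) :* (a :+ (p :+ q) :* l)
                                := X :* (Y :* ((a :+ p :* l) :+ q :* l))) refl _ _ _ _ _ _)

  module Vandermonde (lam a b : Carrier) where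

    -- term (n C k) k (n ∸ k) is the k-th summand of ⟨a+b⟩_{n,λ}.
    term : ℕ → ℕ → ℕ → Carrier
    term c i j = (nat R c * rising R lam b j) * rising R lam a i

    term-+ : ∀ c d i j → term c i j + term d i j ≈ term (c +ℕ d) i j
    term-+ c d i j = trans (sym (distribʳ _ _ _))
      (*-cong (trans (sym (distribʳ _ _ _)) (*-cong (sym (nat-+ c d)) refl)) refl)

    term-0 : ∀ i j → term 0 i j ≈ 0#
    term-0 i j = trans (*-cong (zeroˡ _) refl) (zeroˡ _)

    term-step : ∀ n k → term (n C k) k (n ∸ k) * ((a + b) + nat R n * lam)
                      ≈ term (n C k) (suc k) (n ∸ k) + term (n C k) k (suc n ∸ k)
    term-step n k with k ≤? n
    ... | yes k≤n rewrite ℕ.+-∸-assoc 1 k≤n =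
      trans (*-cong refl (+-cong refl (*-cong n≈k+[n∸k] refl)))
        (solve 8 (λ c B A a b p q l →
           ((c :* B) :* A) :* ((a :+ b) :+ (p :+ q) :* l)
           := (c :* B) :* (A :* (a :+ p :* l)) :+ (c :* (B :* (b :+ q :* l))) :* A)
         refl _ _ _ _ _ _ _ _)
      where
      n≈k+[n∸k] : nat R n ≈ nat R k + nat R (n ∸ k)
      n≈k+[n∸k] = trans (reflexive (≡.cong (nat R) (≡.sym (ℕ.m+[n∸m]≡n k≤n)))) (nat-+ k (n ∸ k))
    ... | no k≰n rewrite k>n⇒nCk≡0 (ℕ.≰⇒> k≰n) =
      trans (*-cong (term-0 k (n ∸ k)) refl)
        (trans (zeroˡ _) (sym (trans (+-cong (term-0 (suc k) (n ∸ k)) (term-0 k (suc n ∸ k)))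
                                     (+-identityʳ _))))

    pascal-sum : ∀ n → sumTo R n (λ k → term (n C k) (suc k) (n ∸ k))
                       + sumTo R n (λ k → term (n C k) k (suc n ∸ k))
                     ≈ sumTo R (suc n) (λ k → term (suc n C k) k (suc n ∸ k))
    pascal-sum n = begin
      G + sumTo R n H                               ≈⟨ +-cong refl (sym (sumTo-suc-last-0 n H H[n+1]≈0)) ⟩
      G + sumTo R (suc n) H                         ≈⟨ +-cong refl (sumTo-suc-shift n H) ⟩
      G + (H 0 + sumTo R n (λ k → H (suc k)))       ≈⟨ solve 3 (λ x y z → x :+ (y :+ z) := y :+ (x :+ z)) refl _ _ _ ⟩
      H 0 + (G + sumTo R n (λ k → H (suc k)))       ≈⟨ +-cong refl (sym (sumTo-+ n _ _)) ⟩
      H 0 + sumTo R n (λ k → term (n C k) (suc k) (n ∸ k) + H (suc k))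
        ≈⟨ +-cong refl (sumTo-cong n pascal) ⟩
      T 0 + sumTo R n (λ k → T (suc k))             ≈⟨ sym (sumTo-suc-shift n T) ⟩
      sumTo R (suc n) T                             ∎
      where
      G : Carrier
      G = sumTo R n (λ k → term (n C k) (suc k) (n ∸ k))
      H T : ℕ → Carrier
      H k = term (n C k) k (suc n ∸ k)
      T k = term (suc n C k) k (suc n ∸ k)
      H[n+1]≈0 : H (suc n) ≈ 0#
      H[n+1]≈0 rewrite k>n⇒nCk≡0 (ℕ.n<1+n n) = term-0 (suc n) (suc n ∸ suc n)
      pascal : ∀ k → term (n C k) (suc k) (n ∸ k) + H (suc k) ≈ T (suc k)
      pascal k rewrite ≡.sym (nCk+nC[k+1]≡[n+1]C[k+1] n k) = term-+ (n C k) (n C suc k) (suc k) (n ∸ k)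

    rising-vandermonde : ∀ n → rising R lam (a + b) n ≈ sumTo R n (λ k → term (n C k) k (n ∸ k))
    rising-vandermonde zero    = sym (trans (*-identityʳ _) (trans (*-identityʳ _) (+-identityʳ _)))
    rising-vandermonde (suc n) = begin
      rising R lam (a + b) n * e                     ≈⟨ *-cong (rising-vandermonde n) refl ⟩
      sumTo R n (λ k → term (n C k) k (n ∸ k)) * e   ≈⟨ sumTo-*ʳ n _ e ⟩
      sumTo R n (λ k → term (n C k) k (n ∸ k) * e)   ≈⟨ sumTo-cong n (term-step n) ⟩
      sumTo R n (λ k → term (n C k) (suc k) (n ∸ k) + term (n C k) k (suc n ∸ k))
        ≈⟨ sumTo-+ n _ _ ⟩
      sumTo R n (λ k → term (n C k) (suc k) (n ∸ k)) + sumTo R n (λ k → term (n C k) k (suc n ∸ k))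
        ≈⟨ pascal-sum n ⟩
      sumTo R (suc n) (λ k → term (suc n C k) k (suc n ∸ k)) ∎
      where e = (a + b) + nat R n * lam

  lamFact-+-stirling1 : ∀ lam m n → lamFact R lam (m +ℕ n)
                        ≈ sumTo R m (λ j → stirling1 R lam m j * rising R lam (1# + nat R m * lam) n)
  lamFact-+-stirling1 lam m n = begin
    rising R lam 1# (m +ℕ n)                                    ≈⟨ rising-+ lam 1# m n ⟩
    rising R lam 1# m * r                                       ≈⟨ *-cong (sym (sumTo-stirling1 lam m)) refl ⟩
    sumTo R m (stirling1 R lam m) * r                           ≈⟨ sumTo-*ʳ m _ r ⟩
    sumTo R m (λ j → stirling1 R lam m j * r)                   ∎
    where r = rising R lam (1# + nat R m * lam) n

  stirling1-rising-vandermonde : ∀ lam m n →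
      sumTo R m (λ j → stirling1 R lam m j * rising R lam (1# + nat R m * lam) n)
    ≈ sumTo R m (λ j → sumTo R n (λ k → ((stirling1 R lam m j * nat R (n C k))
                                          * rising R lam (nat R m * lam) (n ∸ k)) * rising R lam 1# k))
  stirling1-rising-vandermonde lam m n = sumTo-cong m λ j → begin
    s j * rising R lam (1# + nat R m * lam) n                  ≈⟨ *-cong refl (rising-vandermonde n) ⟩
    s j * sumTo R n (λ k → term (n C k) k (n ∸ k))             ≈⟨ sumTo-*ˡ n _ (s j) ⟩
    sumTo R n (λ k → s j * term (n C k) k (n ∸ k))             ≈⟨ sumTo-cong n (λ k → reassoc (s j) _ _ _) ⟩
    sumTo R n (λ k → ((s j * nat R (n C k)) * rising R lam (nat R m * lam) (n ∸ k)) * rising R lam 1# k) ∎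
    where
    open Vandermonde lam 1# (nat R m * lam)
    s : ℕ → Carrier
    s = stirling1 R lam m
    reassoc : ∀ w x y z → w * ((x * y) * z) ≈ ((w * x) * y) * z
    reassoc w x y z = trans (sym (*-assoc w _ z)) (*-cong (sym (*-assoc w x y)) refl)

open CommutativeRing using (Carrier; _≈_; _+_; _*_; 1#)

theorem7 : {c ℓ : Level} (R : CommutativeRing c ℓ) (lam : Carrier R) (m n : ℕ) →
    _≈_ R (lamFact R lam (m +ℕ n))
      (sumTo R m (λ j → _*_ R (stirling1 R lam m j)
                               (rising R lam (_+_ R (1# R) (_*_ R (nat R m) lam)) n)))
    × _≈_ R
      (sumTo R m (λ j → _*_ R (stirling1 R lam m j)
                               (rising R lam (_+_ R (1# R) (_*_ R (nat R m) lam)) n)))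
      (sumTo R m (λ j → sumTo R n (λ k →
           _*_ R (_*_ R (_*_ R (stirling1 R lam m j) (nat R (n C k)))
                        (rising R lam (_*_ R (nat R m) lam) (n ∸ k)))
                 (rising R lam (1# R) k))))
theorem7 R lam m n = lamFact-+-stirling1 R lam m n , stirling1-rising-vandermonde R lam m n
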